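{- Let $k\ge 1$. If $m$ is a positive integer with \[ m\equiv \sum_{i=0}^{k}4^i+2\cdot 4^k \pmod{2\cdot 4^{k+1}}, \] then $m\equiv 5\pmod 8$ and the triple $(m,S(m),S^2(m))$ has permutation pattern $(3,2,1)$, i.e. $S^2(m)<S(m)<m$.
   Context: The Syracuse function $S$ on odd positive integers is defined by $S(m)=(3m+1)/2^e$, where $e$ is the largest integer with $2^e\mid 3m+1$. For a triple $(x_1,x_2,x_3)$ of distinct reals with coordinates in increasing order $y_1<y_2<y_3$, its permutation pattern is the permutation $\sigma$ of $\{1,2,3\}$ with $x_i=y_{\sigma(i)}$, written $(\sigma(1),\sigma(2),\sigma(3))$. -}

module Defs where

open import Data.Nat using (ℕ; zero; suc; _+_; _*_; _^_; _<ᵇ_)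
open import Data.Nat.DivMod using (_%_; _/_)
open import Data.Bool using (Bool; true; false; if_then_else_)
open import Data.Product using (_×_; _,_)

-- Remove all factors of 2 from n, using fuel (fuel ≥ n suffices for n ≥ 1).
oddPartFuel : ℕ → ℕ → ℕ
oddPartFuel zero    n = n
oddPartFuel (suc f) zero = zero
oddPartFuel (suc f) (suc n) with (suc n) % 2
... | zero  = oddPartFuel f ((suc n) / 2)
... | suc _ = suc n

-- odd part of n (n / 2^e with e maximal); oddPart 0 = 0
oddPart : ℕ → ℕ
oddPart n = oddPartFuel n n

-- Syracuse map S(m) = (3m+1)/2^e, e = v₂(3m+1)  (intended for odd m)
S : ℕ → ℕ
S m = oddPart (3 * m + 1)

sumPow4 : ℕ → ℕ
sumPow4 zero    = 1
sumPow4 (suc k) = sumPow4 k + 4 ^ suc k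

-- rank of x among {x, y, z} (1-based; assumes distinct entries)
rank : ℕ → ℕ → ℕ → ℕ
rank x y z = 1 + (if y <ᵇ x then 1 else 0) + (if z <ᵇ x then 1 else 0)

pattern3 : ℕ × ℕ × ℕ → ℕ × ℕ × ℕ
pattern3 (a , b , c) = rank a b c , rank b a c , rank c a b

open import Data.Integer as ℤ using (ℤ; +_)
open import Data.Integer.Divisibility as ℤD using ()

_≡_[mod_] : ℕ → ℕ → ℕ → Set
a ≡ b [mod n ] = (+ n) ℤD.∣ ((+ a) ℤ.- (+ b))

-- Write m = r + q·2·4^(k+1) with r = (4^(k+1) − 1)/3 + 2·4^k. Then 3m + 1 = 2·4^k·(5 + 12q),
-- so S(m) = 5 + 12q, and 3·S(m) + 1 = 4·(4 + 9q). Whenever 4 divides 3x + 1 (and x > 1)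
-- the Syracuse step divides by at least 4, so S(x) ≤ (3x + 1)/4 < x; this applies to both
-- x = m and x = S(m). Finally k ≥ 1 makes every summand of m except 1 + 4 divisible by 8.
module Submission where

open import Defs
open import Data.Nat using (ℕ; suc; _+_; _*_; _^_; _<_; _≤_)
open import Data.Product using (_×_; _,_)
open import Relation.Binary.PropositionalEquality using (_≡_)

open import Data.Nat using (zero; _∸_; _<ᵇ_; z≤n; s≤s; z<s; >-nonZero)
open import Data.Nat.Properties
open import Data.Nat.DivMod using (_%_; _/_; m*n%n≡0; m*n/n≡m; [m+kn]%n≡m%n; m/n≤m)
open import Data.Nat.Divisibility as ℕ using (divides; ∣⇒≤)
open import Data.Nat.Tactic.RingSolver using (solve-∀)
open import Data.Product using (∃-syntax; proj₁; proj₂)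
open import Data.Bool using (true; false)
open import Data.Integer as ℤ using (+_; ∣_∣)
open import Data.Integer.Properties using ([+m]-[+n]≡m⊖n; ⊖-≥; ∣⊖∣-<)
open import Relation.Nullary using (yes; no; contradiction)
open import Relation.Binary.PropositionalEquality using (refl; sym; trans; cong; cong₂; subst; subst₂; module ≡-Reasoning)

oddPartFuel-even : ∀ f n → n % 2 ≡ 0 → oddPartFuel (suc f) n ≡ oddPartFuel f (n / 2)
oddPartFuel-even zero    zero    _ = refl
oddPartFuel-even (suc f) zero    _ = refl
oddPartFuel-even f       (suc n) n%2≡0 with suc n % 2 | n%2≡0
... | zero | _ = refl

oddPartFuel-odd : ∀ f n → n % 2 ≡ 1 → oddPartFuel (suc f) n ≡ n
oddPartFuel-odd f (suc n) n%2≡1 with suc n % 2 | n%2≡1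
... | suc _ | _ = refl

oddPartFuel-≤ : ∀ f n → oddPartFuel f n ≤ n
oddPartFuel-≤ zero    n       = ≤-refl
oddPartFuel-≤ (suc f) zero    = z≤n
oddPartFuel-≤ (suc f) (suc n) with suc n % 2
... | zero  = ≤-trans (oddPartFuel-≤ f (suc n / 2)) (m/n≤m (suc n) 2)
... | suc _ = ≤-refl

oddPartFuel-double : ∀ f n → oddPartFuel (suc f) (2 * n) ≡ oddPartFuel f n
oddPartFuel-double f n = begin
  oddPartFuel (suc f) (2 * n)  ≡⟨ cong (oddPartFuel (suc f)) (*-comm 2 n) ⟩
  oddPartFuel (suc f) (n * 2)  ≡⟨ oddPartFuel-even f (n * 2) (m*n%n≡0 n 2) ⟩
  oddPartFuel f (n * 2 / 2)    ≡⟨ cong (oddPartFuel f) (m*n/n≡m n 2) ⟩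
  oddPartFuel f n              ∎
  where open ≡-Reasoning

oddPartFuel-2^j* : ∀ j f n → oddPartFuel (j + f) (2 ^ j * n) ≡ oddPartFuel f n
oddPartFuel-2^j* zero    f n = cong (oddPartFuel f) (*-identityˡ n)
oddPartFuel-2^j* (suc j) f n = begin
  oddPartFuel (suc (j + f)) (2 * 2 ^ j * n)    ≡⟨ cong (oddPartFuel (suc (j + f))) (*-assoc 2 (2 ^ j) n) ⟩
  oddPartFuel (suc (j + f)) (2 * (2 ^ j * n))  ≡⟨ oddPartFuel-double (j + f) (2 ^ j * n) ⟩
  oddPartFuel (j + f) (2 ^ j * n)              ≡⟨ oddPartFuel-2^j* j f n ⟩
  oddPartFuel f n                              ∎
  where open ≡-Reasoning

n<2^n : ∀ n → n < 2 ^ n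
n<2^n zero    = z<s
n<2^n (suc n) = +-mono-≤ (m^n>0 2 n) (subst (n <_) (sym (*-identityˡ (2 ^ n))) (n<2^n n))

-- The fuel 2^j · n of oddPart exceeds j, so the j halvings leave at least one step of fuel.
oddPart-2^j*≡oddPartFuel : ∀ j n → 0 < n → ∃[ f ] oddPart (2 ^ j * n) ≡ oddPartFuel (suc f) n
oddPart-2^j*≡oddPartFuel j n 0<n = N ∸ suc j , (begin
  oddPartFuel N N                        ≡⟨ cong (λ g → oddPartFuel g N) N≡j+[1+f] ⟩
  oddPartFuel (j + suc (N ∸ suc j)) N    ≡⟨ oddPartFuel-2^j* j (suc (N ∸ suc j)) n ⟩
  oddPartFuel (suc (N ∸ suc j)) n        ∎)
  where
  open ≡-Reasoning
  N = 2 ^ j * n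
  j<N : j < N
  j<N = <-≤-trans (n<2^n j) (m≤m*n (2 ^ j) n {{>-nonZero 0<n}})
  N≡j+[1+f] : N ≡ j + suc (N ∸ suc j)
  N≡j+[1+f] = sym (trans (+-suc j (N ∸ suc j)) (m+[n∸m]≡n j<N))

oddPart-2^j*odd : ∀ j w → oddPart (2 ^ j * (1 + 2 * w)) ≡ 1 + 2 * w
oddPart-2^j*odd j w with oddPart-2^j*≡oddPartFuel j (1 + 2 * w) z<s
... | f , eq = trans eq (oddPartFuel-odd f (1 + 2 * w) odd)
  where
  odd : (1 + 2 * w) % 2 ≡ 1
  odd = trans (cong (λ x → (1 + x) % 2) (*-comm 2 w)) ([m+kn]%n≡m%n 1 w 2)

oddPart-2^j*-≤ : ∀ j n → oddPart (2 ^ j * n) ≤ n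
oddPart-2^j*-≤ j zero    rewrite *-zeroʳ (2 ^ j) = z≤n
oddPart-2^j*-≤ j (suc n) with oddPart-2^j*≡oddPartFuel j (suc n) z<s
... | f , eq = subst (_≤ suc n) (sym eq) (oddPartFuel-≤ (suc f) (suc n))

S-of-2^j*odd : ∀ m j w → 3 * m + 1 ≡ 2 ^ j * (1 + 2 * w) → S m ≡ 1 + 2 * w
S-of-2^j*odd m j w eq = trans (cong oddPart eq) (oddPart-2^j*odd j w)

S<-of-3m+1≡4*n : ∀ m n → 1 < m → 3 * m + 1 ≡ 4 * n → S m < m
S<-of-3m+1≡4*n m n 1<m eq = ≤-<-trans Sm≤n n<m
  where
  Sm≤n : S m ≤ n
  Sm≤n = subst (λ x → oddPart x ≤ n) (sym eq) (oddPart-2^j*-≤ 2 n)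
  4n<4m : 4 * n < 4 * m
  4n<4m = subst₂ _<_ eq (+-comm (3 * m) m) (+-monoʳ-< (3 * m) 1<m)
  n<m : n < m
  n<m = *-cancelˡ-< 4 n m 4n<4m

<⇒<ᵇ≡true : ∀ {m n} → m < n → (m <ᵇ n) ≡ true
<⇒<ᵇ≡true (s≤s z≤n)       = refl
<⇒<ᵇ≡true (s≤s (s≤s m<n)) = <⇒<ᵇ≡true (s≤s m<n)

≥⇒<ᵇ≡false : ∀ {m n} → n ≤ m → (m <ᵇ n) ≡ false
≥⇒<ᵇ≡false z≤n       = refl
≥⇒<ᵇ≡false (s≤s n≤m) = ≥⇒<ᵇ≡false n≤m

pattern3-decreasing : ∀ {x y z} → z < y → y < x → pattern3 (x , y , z) ≡ (3 , 2 , 1)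
pattern3-decreasing z<y y<x
  rewrite <⇒<ᵇ≡true y<x | <⇒<ᵇ≡true (<-trans z<y y<x) | ≥⇒<ᵇ≡false (<⇒≤ y<x)
        | <⇒<ᵇ≡true z<y | ≥⇒<ᵇ≡false (<⇒≤ (<-trans z<y y<x)) | ≥⇒<ᵇ≡false (<⇒≤ z<y) = refl

∣[+m]-[+n]∣≡m∸n : ∀ {m n} → n ≤ m → ∣ + m ℤ.- + n ∣ ≡ m ∸ n
∣[+m]-[+n]∣≡m∸n {m} {n} n≤m = cong ∣_∣ (trans ([+m]-[+n]≡m⊖n m n) (⊖-≥ n≤m))

∣[+m]-[+n]∣≡n∸m : ∀ {m n} → m < n → ∣ + m ℤ.- + n ∣ ≡ n ∸ m
∣[+m]-[+n]∣≡n∸m {m} {n} m<n = trans (cong ∣_∣ ([+m]-[+n]≡m⊖n m n)) (∣⊖∣-< m<n)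

m+k*n≡m[mod] : ∀ m k n → (m + k * n) ≡ m [mod n ]
m+k*n≡m[mod] m k n = divides k (trans (∣[+m]-[+n]∣≡m∸n (m≤m+n m (k * n))) (m+n∸m≡n m (k * n)))

≡[mod]⇒≡+*quotient : ∀ {m r n} → r < n → m ≡ r [mod n ] → ∃[ k ] m ≡ r + k * n
≡[mod]⇒≡+*quotient {m} {r} {n} r<n n∣m-r with r ≤? m
... | yes r≤m with divides k m∸r≡k*n ← subst (n ℕ.∣_) (∣[+m]-[+n]∣≡m∸n r≤m) n∣m-r =
  k , trans (sym (m+[n∸m]≡n r≤m)) (cong (_+_ r) m∸r≡k*n)
... | no r≰m = contradiction (≤-trans n≤r∸m (m∸n≤m r m)) (<⇒≱ r<n)
  where
  m<r = ≰⇒> r≰m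
  n≤r∸m : n ≤ r ∸ m
  n≤r∸m = ∣⇒≤ {{>-nonZero (m<n⇒0<n∸m m<r)}} (subst (n ℕ.∣_) (∣[+m]-[+n]∣≡n∸m m<r) n∣m-r)

sumPow4-geometric : ∀ k → 3 * sumPow4 k + 1 ≡ 4 ^ suc k
sumPow4-geometric zero    = refl
sumPow4-geometric (suc k) = begin
  3 * (sumPow4 k + a) + 1    ≡⟨ distribute (sumPow4 k) a ⟩
  3 * sumPow4 k + 1 + 3 * a  ≡⟨ cong (_+ 3 * a) (sumPow4-geometric k) ⟩
  a + 3 * a                  ≡⟨⟩
  4 * a                      ∎
  where
  open ≡-Reasoning
  a = 4 ^ suc k
  distribute : ∀ s a → 3 * (s + a) + 1 ≡ 3 * s + 1 + 3 * a
  distribute = solve-∀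

sumPow4[1+j]≡5+u*8 : ∀ j → ∃[ u ] sumPow4 (suc j) ≡ 5 + u * 8
sumPow4[1+j]≡5+u*8 zero    = 0 , refl
sumPow4[1+j]≡5+u*8 (suc j) with u , eq ← sumPow4[1+j]≡5+u*8 j =
  u + 2 * 4 ^ j , trans (cong (_+ 4 ^ suc (suc j)) eq) (regroup u (4 ^ j))
  where
  regroup : ∀ u a → 5 + u * 8 + 4 * (4 * a) ≡ 5 + (u + 2 * a) * 8
  regroup = solve-∀

sumPow4+2*4^k<2*4^[1+k] : ∀ k → sumPow4 k + 2 * 4 ^ k < 2 * 4 ^ suc k
sumPow4+2*4^k<2*4^[1+k] k = begin-strict
  s + 2 * a              <⟨ +-monoˡ-< (2 * a) s<4a ⟩
  4 * a + 2 * a          ≤⟨ m≤m+n (4 * a + 2 * a) (2 * a) ⟩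
  4 * a + 2 * a + 2 * a  ≡⟨ regroup a ⟩
  2 * (4 * a)            ∎
  where
  open ≤-Reasoning
  s = sumPow4 k
  a = 4 ^ k
  s<4a : s < 4 * a
  s<4a = begin-strict
    s          ≤⟨ m≤m+n s (2 * s) ⟩
    3 * s      <⟨ m<m+n (3 * s) z<s ⟩
    3 * s + 1  ≡⟨ sumPow4-geometric k ⟩
    4 * a      ∎
  regroup : ∀ a → 4 * a + 2 * a + 2 * a ≡ 2 * (4 * a)
  regroup = solve-∀

3m+1-of-residue : ∀ k q → 3 * (sumPow4 k + 2 * 4 ^ k + q * (2 * 4 ^ suc k)) + 1 ≡ 2 * 4 ^ k * (5 + 12 * q)
3m+1-of-residue k q = begin
  3 * (s + 2 * a + q * (2 * (4 * a))) + 1  ≡⟨ distribute s a q ⟩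
  3 * s + 1 + 2 * a * (3 + 12 * q)         ≡⟨ cong (_+ 2 * a * (3 + 12 * q)) (sumPow4-geometric k) ⟩
  4 * a + 2 * a * (3 + 12 * q)             ≡⟨ factor a q ⟩
  2 * a * (5 + 12 * q)                     ∎
  where
  open ≡-Reasoning
  s = sumPow4 k
  a = 4 ^ k
  distribute : ∀ s a q → 3 * (s + 2 * a + q * (2 * (4 * a))) + 1 ≡ 3 * s + 1 + 2 * a * (3 + 12 * q)
  distribute = solve-∀
  factor : ∀ a q → 4 * a + 2 * a * (3 + 12 * q) ≡ 2 * a * (5 + 12 * q)
  factor = solve-∀

residue-≡5+v*8 : ∀ j q → ∃[ v ] sumPow4 (suc j) + 2 * 4 ^ suc j + q * (2 * 4 ^ suc (suc j)) ≡ 5 + v * 8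
residue-≡5+v*8 j q with u , eq ← sumPow4[1+j]≡5+u*8 j =
  u + a + q * (4 * a) , trans (cong (λ s → s + 2 * (4 * a) + q * (2 * (4 * (4 * a)))) eq) (regroup u a q)
  where
  a = 4 ^ j
  regroup : ∀ u a q → 5 + u * 8 + 2 * (4 * a) + q * (2 * (4 * (4 * a))) ≡ 5 + (u + a + q * (4 * a)) * 8
  regroup = solve-∀

2*4^k≡2^[1+2k] : ∀ k → 2 * 4 ^ k ≡ 2 ^ (1 + 2 * k)
2*4^k≡2^[1+2k] k = cong (2 *_) (^-*-assoc 2 2 k)

S-of-2*4^k*[5+12q] : ∀ m k q → 3 * m + 1 ≡ 2 * 4 ^ k * (5 + 12 * q) → S m ≡ 5 + 12 * q
S-of-2*4^k*[5+12q] m k q eq =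
  trans (S-of-2^j*odd m (1 + 2 * k) (2 + 6 * q) (trans eq (cong₂ _*_ (2*4^k≡2^[1+2k] k) (odd-form q))))
        (sym (odd-form q))
  where
  odd-form : ∀ q → 5 + 12 * q ≡ 1 + 2 * (2 + 6 * q)
  odd-form = solve-∀

S[5+12q]<5+12q : ∀ q → S (5 + 12 * q) < 5 + 12 * q
S[5+12q]<5+12q q = S<-of-3m+1≡4*n (5 + 12 * q) (4 + 9 * q) (s≤s (s≤s z≤n)) (factor q)
  where
  factor : ∀ q → 3 * (5 + 12 * q) + 1 ≡ 4 * (4 + 9 * q)
  factor = solve-∀

mainTheorem5 : (k m : ℕ) → 1 ≤ k → 0 < m →
               m ≡ sumPow4 k + 2 * 4 ^ k [mod 2 * 4 ^ suc k ] →
               (m ≡ 5 [mod 8 ]) × (pattern3 (m , S m , S (S m)) ≡ (3 , 2 , 1)) × (S (S m) < S m) × (S m < m)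
mainTheorem5 (suc j) m _ _ m≡r
  with q , m≡r+qM ← ≡[mod]⇒≡+*quotient (sumPow4+2*4^k<2*4^[1+k] (suc j)) m≡r =
  m≡5[mod8] , pattern3-decreasing SSm<Sm Sm<m , SSm<Sm , Sm<m
  where
  v : ℕ
  v = proj₁ (residue-≡5+v*8 j q)
  m≡5+v8 : m ≡ 5 + v * 8
  m≡5+v8 = trans m≡r+qM (proj₂ (residue-≡5+v*8 j q))
  m≡5[mod8] : m ≡ 5 [mod 8 ]
  m≡5[mod8] = subst (_≡ 5 [mod 8 ]) (sym m≡5+v8) (m+k*n≡m[mod] 5 v 8)
  3m+1≡ : 3 * m + 1 ≡ 2 * 4 ^ suc j * (5 + 12 * q)
  3m+1≡ = trans (cong (λ x → 3 * x + 1) m≡r+qM) (3m+1-of-residue (suc j) q)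
  Sm≡5+12q : S m ≡ 5 + 12 * q
  Sm≡5+12q = S-of-2*4^k*[5+12q] m (suc j) q 3m+1≡
  SSm<Sm : S (S m) < S m
  SSm<Sm = subst (λ x → S x < x) (sym Sm≡5+12q) (S[5+12q]<5+12q q)
  regroup : ∀ a x → 2 * (4 * a) * x ≡ 4 * (2 * a * x)
  regroup = solve-∀
  Sm<m : S m < m
  Sm<m = S<-of-3m+1≡4*n m (2 * 4 ^ j * (5 + 12 * q)) (subst (1 <_) (sym m≡5+v8) (s≤s (s≤s z≤n)))
                        (trans 3m+1≡ (regroup (4 ^ j) (5 + 12 * q)))
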